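{- Let $G=(V,E)$ be a simple graph of order $n$. Then $$P(\mathcal{H}_{\bullet G},\lambda)=\lambda(\lambda-1)^n\, I\!\left(G,\tfrac{1}{\lambda-1}\right).$$
   Context: A hypergraph $\mathcal{H}=(\mathcal{V},\mathcal{E})$ consists of a finite vertex set $\mathcal{V}$ and a set $\mathcal{E}$ of subsets $e\subseteq\mathcal{V}$ with $|e|\ge 1$ (edges). For a positive integer $\lambda$, a weak proper $\lambda$-colouring of $\mathcal{H}$ is a map $\phi:\mathcal{V}\to\{1,\dots,\lambda\}$ such that $|\{\phi(v):v\in e\}|>1$ for every $e\in\mathcal{E}$. The chromatic polynomial $P(\mathcal{H},\lambda)$ is the polynomial in $\lambda$ (of degree $|\mathcal{V}|$) whose value at each positive integer $\lambda$ is the number of weak proper $\lambda$-colourings of $\mathcal{H}$. For a simple graph $G=(V,E)$, $\mathcal{H}_{\bullet G}$ is the hypergraph with vertex set $V\cup\{w\}$, where $w\notin V$ is a new vertex, and edge set $\{\{u,v,w\}: uv\in E\}$. The independence polynomial of $G$ is $I(G,x)=\sum_A x^{|A|}$, the sum over all independent sets $A$ of $G$ (including the empty set). -}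

module Defs where

open import Data.Nat using (ℕ; zero; suc; _<_)
open import Data.Bool using (Bool; true; false; _∧_; _∨_; not; if_then_else_)
open import Data.Fin using (Fin; zero; suc; _≟_)
open import Data.List using (List; []; _∷_; map; filter; length; concatMap; foldr; allFin)
open import Data.Bool.ListAction using (any; all)
open import Data.Vec.Functional using (Vector)
open import Relation.Nullary.Decidable using (does; ⌊_⌋)
open import Data.Rational using (ℚ; 0ℚ; 1ℚ; _+_; _*_)
open import Relation.Binary.PropositionalEquality using (_≡_)
open import Data.Product using (_×_)

allFuns : {A : Set} → List A → (m : ℕ) → List (Fin m → A)
allFuns as zero    = (λ ()) ∷ []
allFuns as (suc m) =
  concatMap (λ a → map (λ f → λ { zero → a ; (suc i) → f i }) (allFuns as m)) as

allSubsets : (m : ℕ) → List (Fin m → Bool)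
allSubsets = allFuns (true ∷ false ∷ [])

card : {m : ℕ} → (Fin m → Bool) → ℕ
card {m} S = length (filter (λ i → S i ≟b true) (allFin m))
  where
  open import Data.Bool.Properties using () renaming (_≟_ to _≟b_)

-- Hypergraphs on vertex set Fin m; an edge is a subset of the vertex set
-- (characteristic function). (Non-emptiness of edges is not recorded;
-- all edges of H_{•G} contain w anyway.)

record Hypergraph : Set where
  field
    m        : ℕ
    edges    : List (Fin m → Bool)
open Hypergraph public

coloursOn : {m q : ℕ} → (Fin m → Fin q) → (Fin m → Bool) → List (Fin q)
coloursOn {m} {q} φ e =
  filter (λ c → any (λ v → e v ∧ ⌊ φ v ≟ c ⌋) (allFin m) ≟b true) (allFin q)
  where
  open import Data.Bool.Properties using () renaming (_≟_ to _≟b_)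

isWeakProper : (H : Hypergraph) {q : ℕ} → (Fin (m H) → Fin q) → Bool
isWeakProper H φ = all (λ e → ⌊ 1 <? length (coloursOn φ e) ⌋) (edges H)
  where open import Data.Nat using (_<?_)

-- Number of weak proper q-colourings, i.e. the value P(H, q) of the
-- chromatic polynomial at the positive integer q.
numColourings : Hypergraph → ℕ → ℕ
numColourings H q =
  length (filter (λ φ → isWeakProper H φ ≟b true) (allFuns (allFin q) (m H)))
  where
  open import Data.Bool.Properties using () renaming (_≟_ to _≟b_)

record SimpleGraph (n : ℕ) : Set where
  field
    adj     : Fin n → Fin n → Bool
    sym     : ∀ u v → adj u v ≡ adj v u
    irrefl  : ∀ v → adj v v ≡ false
open SimpleGraph public

isIndependent : {n : ℕ} → SimpleGraph n → (Fin n → Bool) → Bool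
isIndependent {n} G A =
  all (λ u → all (λ v → not (A u ∧ A v ∧ adj G u v)) (allFin n)) (allFin n)

_^ℚ_ : ℚ → ℕ → ℚ
x ^ℚ zero  = 1ℚ
x ^ℚ suc k = x * (x ^ℚ k)

indepPoly : {n : ℕ} → SimpleGraph n → ℚ → ℚ
indepPoly {n} G x =
  foldr (λ A acc → (x ^ℚ card A) + acc) 0ℚ
    (filter (λ A → isIndependent G A ≟b true) (allSubsets n))
  where
  open import Data.Bool.Properties using () renaming (_≟_ to _≟b_)

-- H_{•G}: vertex set V ∪ {w}, realised as Fin (suc n) with w = zero and
-- v ∈ V as suc v; edges {u, v, w} for every edge uv of G
-- (each edge listed once per ordered pair (u,v) with u adjacent to v;
-- duplicates do not affect the colouring count).

tripleEdge : {n : ℕ} → Fin n → Fin n → (Fin (suc n) → Bool)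
tripleEdge u v zero    = true
tripleEdge u v (suc x) = ⌊ x ≟ u ⌋ ∨ ⌊ x ≟ v ⌋

hyperBullet : {n : ℕ} → SimpleGraph n → Hypergraph
hyperBullet {n} G = record
  { m        = suc n
  ; edges    = concatMap (λ u → concatMap (λ v → if adj G u v then tripleEdge u v ∷ [] else [])
                                  (allFin n)) (allFin n)
  }

module Submission where

-- Write w = zero for the apex of H_{•G} and v ↦ suc v for the vertices of G.
-- For a colouring φ, let A_φ ⊆ V be the colour class of φ(w) among the
-- vertices of G.  The proof has three steps.
--
-- 1. An edge {u,v,w} sees a single colour exactly when u, v ∈ A_φ, so φ is
--    weakly proper iff A_φ is independent in G ('weakProper⇔independent').
-- 2. Fixing a colour c out of λ = p+1, the maps f : V → [λ] whose colour
--    class of c is A are exactly the maps V∖A → [λ]∖{c}; so for any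
--    predicate Q on subsets, #{f : Q(f⁻¹(c))} = Σ_{A ∈ Q} p^{n-|A|}
--    ('count-by-colourClass', by induction on n).  Summing over φ(w) gives
--    P(H_{•G}, λ) = λ Σ_{A independent} (λ-1)^{n-|A|}  ('colouringCount').
-- 3. In ℚ, (λ-1)^{n-|A|} = (λ-1)^n (1/(λ-1))^{|A|}; summing over the
--    independent sets A gives the claim ('weightedSum-in-ℚ').

module Counting where

  open import Defs hiding (sym)
  open import Data.Nat using (ℕ; zero; suc; _+_; _*_; _^_; _≤_; _<?_; z≤n; s≤s)
  open import Data.Nat.Properties
    using (+-suc; +-identityʳ; +-commutativeSemigroup; *-distribˡ-+; *-zeroʳ; m≤n⇒m≤1+n; ≤⇒≯)
  open import Data.Nat.ListAction using (sum)
  open import Data.Nat.ListAction.Properties using (sum-++)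
  open import Data.Bool using (Bool; true; false; _∧_; not; if_then_else_)
  open import Data.Bool.Properties using (T-≡; T-∧; T-∨; ∧-assoc; ∧-zeroʳ; ∧-identityʳ) renaming (_≟_ to _≟b_)
  open import Data.Bool.ListAction using (any; all; and)
  open import Data.Fin using (Fin; zero; suc; _≟_)
  open import Data.List using (List; []; _∷_; _++_; map; filter; length; concatMap; allFin; tabulate)
  open import Data.List.Properties using (filter-++; map-++; map-∘; map-cong; map-tabulate; length-map; length-tabulate)
  open import Data.List.Relation.Unary.Any using (here; there)
  open import Data.List.Relation.Unary.Any.Properties using (any⁺; any⁻)
  open import Data.List.Relation.Unary.All using (_∷_)
  open import Data.List.Relation.Unary.AllPairs using (_∷_)
  open import Data.List.Relation.Unary.Unique.Propositional using (Unique)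
  import Data.List.Relation.Unary.Unique.Propositional.Properties as Unique
  open import Data.List.Membership.Propositional using (_∈_; lose; find)
  open import Data.List.Membership.Propositional.Properties using (∈-filter⁺; ∈-filter⁻; ∈-allFin; ∈-length)
  open import Data.Product using (∃; _×_; _,_)
  open import Data.Sum using (_⊎_; inj₁; inj₂)
  open import Data.Empty using (⊥-elim)
  open import Function using (_∘_; Equivalence)
  open import Algebra.Properties.CommutativeSemigroup +-commutativeSemigroup using (x∙yz≈y∙xz)
  open import Relation.Nullary.Decidable using (⌊_⌋; yes; no; toWitness; fromWitness)
  open import Relation.Binary.PropositionalEquality
    using (_≡_; _≢_; refl; sym; trans; cong; cong₂; module ≡-Reasoning)

  -- Weighted counting over lists

  select : {X : Set} → (X → Bool) → List X → List X
  select P = filter (λ x → P x ≟b true)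

  weightedCount : {X : Set} → (X → ℕ) → (X → Bool) → List X → ℕ
  weightedCount w P xs = sum (map w (select P xs))

  select-cong : {X : Set} {P Q : X → Bool} → (∀ x → P x ≡ Q x) → ∀ xs → select P xs ≡ select Q xs
  select-cong P≗Q [] = refl
  select-cong {P = P} {Q} P≗Q (x ∷ xs) with P x | Q x | P≗Q x
  ... | true  | .true  | refl = cong (x ∷_) (select-cong P≗Q xs)
  ... | false | .false | refl = select-cong P≗Q xs

  select-map : {X Y : Set} (P : Y → Bool) (f : X → Y) → ∀ xs → select P (map f xs) ≡ map f (select (P ∘ f) xs)
  select-map P f [] = refl
  select-map P f (x ∷ xs) with P (f x)
  ... | true  = cong (f x ∷_) (select-map P f xs)
  ... | false = select-map P f xs

  weightedCount-cong : {X : Set} {v w : X → ℕ} {P Q : X → Bool} → (∀ x → v x ≡ w x) → (∀ x → P x ≡ Q x) →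
    ∀ xs → weightedCount v P xs ≡ weightedCount w Q xs
  weightedCount-cong {w = w} {P = P} v≗w P≗Q xs =
    trans (cong sum (map-cong v≗w (select P xs))) (cong (sum ∘ map w) (select-cong P≗Q xs))

  weightedCount-map : {X Y : Set} (w : Y → ℕ) (P : Y → Bool) (f : X → Y) → ∀ xs →
    weightedCount w P (map f xs) ≡ weightedCount (w ∘ f) (P ∘ f) xs
  weightedCount-map w P f xs = begin
    sum (map w (select P (map f xs)))        ≡⟨ cong (sum ∘ map w) (select-map P f xs) ⟩
    sum (map w (map f (select (P ∘ f) xs)))  ≡⟨ cong sum (map-∘ (select (P ∘ f) xs)) ⟨
    sum (map (w ∘ f) (select (P ∘ f) xs))    ∎
    where open ≡-Reasoning

  weightedCount-++ : {X : Set} (w : X → ℕ) (P : X → Bool) → ∀ xs ys →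
    weightedCount w P (xs ++ ys) ≡ weightedCount w P xs + weightedCount w P ys
  weightedCount-++ w P xs ys = begin
    sum (map w (select P (xs ++ ys)))                  ≡⟨ cong (sum ∘ map w) (filter-++ _ xs ys) ⟩
    sum (map w (select P xs ++ select P ys))           ≡⟨ cong sum (map-++ w (select P xs) _) ⟩
    sum (map w (select P xs) ++ map w (select P ys))   ≡⟨ sum-++ (map w (select P xs)) _ ⟩
    weightedCount w P xs + weightedCount w P ys        ∎
    where open ≡-Reasoning

  weightedCount-concatMap : {X Y : Set} (w : Y → ℕ) (P : Y → Bool) (g : X → List Y) → ∀ xs →
    weightedCount w P (concatMap g xs) ≡ sum (map (λ x → weightedCount w P (g x)) xs)
  weightedCount-concatMap w P g [] = refl
  weightedCount-concatMap w P g (x ∷ xs) =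
    trans (weightedCount-++ w P (g x) (concatMap g xs))
          (cong (weightedCount w P (g x) +_) (weightedCount-concatMap w P g xs))

  weightedCount-scale : {X : Set} (c : ℕ) (w : X → ℕ) (P : X → Bool) → ∀ xs →
    weightedCount (λ x → c * w x) P xs ≡ c * weightedCount w P xs
  weightedCount-scale c w P xs = sum-scale (select P xs)
    where
    sum-scale : ∀ ys → sum (map (λ x → c * w x) ys) ≡ c * sum (map w ys)
    sum-scale []       = sym (*-zeroʳ c)
    sum-scale (y ∷ ys) = trans (cong (c * w y +_) (sum-scale ys)) (sym (*-distribˡ-+ c (w y) _))

  count : {X : Set} → (X → Bool) → List X → ℕ
  count P xs = length (select P xs)

  count-as-weightedCount : {X : Set} (P : X → Bool) → ∀ xs → count P xs ≡ weightedCount (λ _ → 1) P xs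
  count-as-weightedCount P xs = length-as-sum (select P xs)
    where
    length-as-sum : ∀ ys → length ys ≡ sum (map (λ _ → 1) ys)
    length-as-sum []       = refl
    length-as-sum (y ∷ ys) = cong suc (length-as-sum ys)

  count-∷ : {X : Set} (P : X → Bool) (x : X) (xs : List X) → count P (x ∷ xs) ≡ (if P x then 1 else 0) + count P xs
  count-∷ P x xs with P x
  ... | true  = refl
  ... | false = refl

  cons : {X : Set} {m : ℕ} → X → (Fin m → X) → Fin (suc m) → X
  cons a f zero    = a
  cons a f (suc i) = f i

  -- Functionals on Fin m → X that only depend on the values of their argument
  -- (there is no function extensionality, so this is tracked explicitly).
  Extensional : {X Y : Set} {m : ℕ} → ((Fin m → X) → Y) → Set
  Extensional F = ∀ f g → (∀ i → f i ≡ g i) → F f ≡ F g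

  weightedCount-allFuns : {X : Set} (as : List X) (m : ℕ)
    (w : (Fin (suc m) → X) → ℕ) (P : (Fin (suc m) → X) → Bool) → Extensional w → Extensional P →
    weightedCount w P (allFuns as (suc m))
      ≡ sum (map (λ a → weightedCount (w ∘ cons a) (P ∘ cons a) (allFuns as m)) as)
  weightedCount-allFuns {X} as m w P w-ext P-ext = split _ (λ { a f zero → refl ; a f (suc i) → refl })
    where
    -- allFuns as (suc m) is built from a function pointwise equal to cons.
    split : (h : X → (Fin m → X) → Fin (suc m) → X) → (∀ a f i → h a f i ≡ cons a f i) →
      weightedCount w P (concatMap (λ a → map (h a) (allFuns as m)) as)
        ≡ sum (map (λ a → weightedCount (w ∘ cons a) (P ∘ cons a) (allFuns as m)) as)
    split h h≗cons =
      trans (weightedCount-concatMap w P (λ a → map (h a) (allFuns as m)) as)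
            (cong sum (map-cong (λ a →
              trans (weightedCount-map w P (h a) (allFuns as m))
                    (weightedCount-cong (λ f → w-ext _ _ (h≗cons a f)) (λ f → P-ext _ _ (h≗cons a f))
                                        (allFuns as m))) as))

  ≟-suc : {q : ℕ} (i c : Fin q) → ⌊ suc i ≟ suc c ⌋ ≡ ⌊ i ≟ c ⌋
  ≟-suc i c with i ≟ c
  ... | yes _ = refl
  ... | no  _ = refl

  sum-tabulate-const : (m x : ℕ) → sum (tabulate {n = m} (λ _ → x)) ≡ m * x
  sum-tabulate-const zero    x = refl
  sum-tabulate-const (suc m) x = cong (x +_) (sum-tabulate-const m x)

  sum-colours : (p : ℕ) (c : Fin (suc p)) (g : Bool → ℕ) →
    sum (map (λ a → g ⌊ a ≟ c ⌋) (allFin (suc p))) ≡ g true + p * g false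
  sum-colours p c g = trans (cong sum (map-tabulate (λ a → a) (λ a → g ⌊ a ≟ c ⌋))) (over-tabulate p c)
    where
    over-tabulate : (p : ℕ) (c : Fin (suc p)) → sum (tabulate (λ a → g ⌊ a ≟ c ⌋)) ≡ g true + p * g false
    over-tabulate p       zero    = cong (g true +_) (sum-tabulate-const p (g false))
    over-tabulate (suc p) (suc c) = begin
      g false + sum (tabulate (λ a → g ⌊ suc a ≟ suc c ⌋))
        ≡⟨ cong (λ xs → g false + sum xs) (map-tabulate (λ a → a) (λ a → g ⌊ suc a ≟ suc c ⌋)) ⟨
      g false + sum (map (λ a → g ⌊ suc a ≟ suc c ⌋) (allFin (suc p)))
        ≡⟨ cong (λ xs → g false + sum xs) (map-cong (λ a → cong g (≟-suc a c)) (allFin (suc p))) ⟩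
      g false + sum (map (λ a → g ⌊ a ≟ c ⌋) (allFin (suc p)))
        ≡⟨ cong (g false +_) (sum-colours p c g) ⟩
      g false + (g true + p * g false)
        ≡⟨ x∙yz≈y∙xz (g false) (g true) (p * g false) ⟩
      g true + (g false + p * g false) ∎
      where open ≡-Reasoning

  card-suc : {m : ℕ} (S : Fin (suc m) → Bool) → card S ≡ (if S zero then 1 else 0) + card (λ i → S (suc i))
  card-suc {m} S = begin
    count S (zero ∷ tabulate suc)                              ≡⟨ count-∷ S zero (tabulate suc) ⟩
    b + count S (tabulate suc)                                 ≡⟨ cong (λ xs → b + count S xs) (map-tabulate (λ i → i) suc) ⟨
    b + count S (map suc (allFin m))                           ≡⟨ cong (λ xs → b + length xs) (select-map S suc (allFin m)) ⟩
    b + length (map suc (select (S ∘ suc) (allFin m)))         ≡⟨ cong (b +_) (length-map suc (select (S ∘ suc) (allFin m))) ⟩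
    b + card (λ i → S (suc i))                                 ∎
    where
    open ≡-Reasoning
    b = if S zero then 1 else 0

  count-complement : {X : Set} (P : X → Bool) → ∀ xs → count P xs + count (λ x → not (P x)) xs ≡ length xs
  count-complement P [] = refl
  count-complement P (x ∷ xs) with P x
  ... | true  = cong suc (count-complement P xs)
  ... | false = trans (+-suc _ _) (cong suc (count-complement P xs))

  coCard : {m : ℕ} → (Fin m → Bool) → ℕ
  coCard A = card (λ v → not (A v))

  card+coCard : {m : ℕ} (A : Fin m → Bool) → card A + coCard A ≡ m
  card+coCard {m} A = trans (count-complement A (allFin m)) (length-tabulate (λ i → i))

  coCard-ext : {m : ℕ} → Extensional (coCard {m})
  coCard-ext {m} A B A≗B = cong length (select-cong (λ v → cong not (A≗B v)) (allFin m))

  -- The weight p^{|V∖A|} of a subset A: the number of ways to colour V ∖ A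
  -- with p colours.
  weight : (p : ℕ) {m : ℕ} → (Fin m → Bool) → ℕ
  weight p A = p ^ coCard A

  weight-ext : (p m : ℕ) → Extensional (weight p {m})
  weight-ext p m A B A≗B = cong (p ^_) (coCard-ext A B A≗B)

  -- Counting maps by a colour class

  colourClass : {n q : ℕ} → Fin q → (Fin n → Fin q) → Fin n → Bool
  colourClass c f v = ⌊ f v ≟ c ⌋

  -- For a fixed colour c among p + 1, a subset A is the colour class of c for
  -- exactly p^{|V∖A|} maps V → Fin (suc p).
  count-by-colourClass : (p n : ℕ) (Q : (Fin n → Bool) → Bool) → Extensional Q → (c : Fin (suc p)) →
    count (Q ∘ colourClass c) (allFuns (allFin (suc p)) n) ≡ weightedCount (weight p) Q (allSubsets n)
  count-by-colourClass p zero Q Q-ext c = single _ _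
    where
    single : (f : Fin 0 → Fin (suc p)) (A : Fin 0 → Bool) →
      count (Q ∘ colourClass c) (f ∷ []) ≡ weightedCount (weight p) Q (A ∷ [])
    single f A rewrite Q-ext (colourClass c f) A (λ ()) with Q A
    ... | true  = refl
    ... | false = refl
  count-by-colourClass p (suc n) Q Q-ext c = begin
    count (Q ∘ colourClass c) (allFuns colours (suc n))
      ≡⟨ count-as-weightedCount (Q ∘ colourClass c) (allFuns colours (suc n)) ⟩
    weightedCount (λ _ → 1) (Q ∘ colourClass c) (allFuns colours (suc n))
      ≡⟨ weightedCount-allFuns colours n (λ _ → 1) (Q ∘ colourClass c) (λ _ _ _ → refl)
           (λ f g f≗g → Q-ext _ _ (λ v → cong (λ a → ⌊ a ≟ c ⌋) (f≗g v))) ⟩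
    sum (map (λ a → weightedCount (λ _ → 1) (Q ∘ colourClass c ∘ cons a) (allFuns colours n)) colours)
      ≡⟨ cong sum (map-cong fibre colours) ⟩
    sum (map (λ a → R ⌊ a ≟ c ⌋) colours)
      ≡⟨ sum-colours p c R ⟩
    R true + p * R false
      ≡⟨ cong₂ _+_ fibre-in fibre-out ⟨
    sum (map (λ b → weightedCount (weight p ∘ cons b) (Q ∘ cons b) (allSubsets n)) (true ∷ false ∷ []))
      ≡⟨ weightedCount-allFuns (true ∷ false ∷ []) n (weight p) Q (weight-ext p (suc n)) Q-ext ⟨
    weightedCount (weight p) Q (allSubsets (suc n)) ∎
    where
    open ≡-Reasoning
    colours = allFin (suc p)

    -- The contribution of subsets of the remaining n vertices, after
    -- deciding whether vertex zero lies in the subset.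
    R : Bool → ℕ
    R b = weightedCount (weight p) (Q ∘ cons b) (allSubsets n)

    fibre : (a : Fin (suc p)) →
      weightedCount (λ _ → 1) (Q ∘ colourClass c ∘ cons a) (allFuns colours n) ≡ R ⌊ a ≟ c ⌋
    fibre a = begin
      weightedCount (λ _ → 1) (Q ∘ colourClass c ∘ cons a) (allFuns colours n)
        ≡⟨ weightedCount-cong (λ _ → refl) (λ f → Q-ext _ _ (class-cons f)) (allFuns colours n) ⟩
      weightedCount (λ _ → 1) (Q ∘ cons ⌊ a ≟ c ⌋ ∘ colourClass c) (allFuns colours n)
        ≡⟨ count-as-weightedCount (Q ∘ cons ⌊ a ≟ c ⌋ ∘ colourClass c) (allFuns colours n) ⟨
      count (Q ∘ cons ⌊ a ≟ c ⌋ ∘ colourClass c) (allFuns colours n)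
        ≡⟨ count-by-colourClass p n (Q ∘ cons ⌊ a ≟ c ⌋)
             (λ A B A≗B → Q-ext _ _ λ { zero → refl ; (suc i) → A≗B i }) c ⟩
      R ⌊ a ≟ c ⌋ ∎
      where
      class-cons : (f : Fin n → Fin (suc p)) → ∀ i → colourClass c (cons a f) i ≡ cons ⌊ a ≟ c ⌋ (colourClass c f) i
      class-cons f zero    = refl
      class-cons f (suc i) = refl

    -- Vertex zero in the subset costs nothing; outside it, it takes one of p colours.
    fibre-in : weightedCount (weight p ∘ cons true) (Q ∘ cons true) (allSubsets n) ≡ R true
    fibre-in = weightedCount-cong (λ A → cong (p ^_) (card-suc (λ v → not (cons true A v)))) (λ _ → refl)
                                  (allSubsets n)

    fibre-out : weightedCount (weight p ∘ cons false) (Q ∘ cons false) (allSubsets n) + 0 ≡ p * R false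
    fibre-out = trans (+-identityʳ _)
      (trans (weightedCount-cong (λ A → cong (p ^_) (card-suc (λ v → not (cons false A v)))) (λ _ → refl)
                                (allSubsets n))
             (weightedCount-scale p (weight p) (Q ∘ cons false) (allSubsets n)))

  length≤1 : {X : Set} {a : X} {xs : List X} → Unique xs → (∀ {x} → x ∈ xs → x ≡ a) → length xs ≤ 1
  length≤1 {xs = []}        _                         _    = z≤n
  length≤1 {xs = _ ∷ []}    _                         _    = s≤s z≤n
  length≤1 {xs = _ ∷ _ ∷ _} ((x≢y ∷ _) ∷ _) all≡a = ⊥-elim (x≢y (trans (all≡a (here refl)) (sym (all≡a (there (here refl))))))

  length≥2 : {X : Set} {a b : X} {xs : List X} → a ∈ xs → b ∈ xs → a ≢ b → 2 ≤ length xs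
  length≥2 (here refl) (here refl) a≢b = ⊥-elim (a≢b refl)
  length≥2 (here _)    (there b∈)  _   = s≤s (∈-length b∈)
  length≥2 (there a∈)  (here _)    _   = s≤s (∈-length a∈)
  length≥2 (there a∈)  (there b∈)  a≢b = m≤n⇒m≤1+n (length≥2 a∈ b∈ a≢b)

  module _ {m q : ℕ} (φ : Fin m → Fin q) (e : Fin m → Bool) where

    occursOn : Fin q → Bool
    occursOn c = any (λ v → e v ∧ ⌊ φ v ≟ c ⌋) (allFin m)

    coloursOn-unique : Unique (coloursOn φ e)
    coloursOn-unique = Unique.filter⁺ (λ c → occursOn c ≟b true) (Unique.allFin⁺ q)

    ∈-coloursOn⁺ : {v : Fin m} → e v ≡ true → φ v ∈ coloursOn φ e
    ∈-coloursOn⁺ {v} v∈e = ∈-filter⁺ (λ c → occursOn c ≟b true) (∈-allFin (φ v)) occurs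
      where
      occurs : occursOn (φ v) ≡ true
      occurs = Equivalence.to T-≡ (any⁺ _ (lose (∈-allFin v)
                 (Equivalence.from T-∧ (Equivalence.from T-≡ v∈e , fromWitness refl))))

    ∈-coloursOn⁻ : {c : Fin q} → c ∈ coloursOn φ e → ∃ λ v → e v ≡ true × φ v ≡ c
    ∈-coloursOn⁻ {c} c∈ with ∈-filter⁻ (λ c → occursOn c ≟b true) {xs = allFin q} c∈
    ... | _ , occurs with find (any⁻ _ (allFin m) (Equivalence.from T-≡ occurs))
    ... | v , _ , v-ok with Equivalence.to T-∧ v-ok
    ... | v∈e , φv≡c = v , Equivalence.to T-≡ v∈e , toWitness φv≡c

    monochromatic : {c : Fin q} → (∀ v → e v ≡ true → φ v ≡ c) → length (coloursOn φ e) ≤ 1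
    monochromatic all≡c = length≤1 coloursOn-unique λ c′∈ →
      let v , v∈e , φv≡c′ = ∈-coloursOn⁻ c′∈ in trans (sym φv≡c′) (all≡c v v∈e)

    bichromatic : {x y : Fin m} → e x ≡ true → e y ≡ true → φ x ≢ φ y → 2 ≤ length (coloursOn φ e)
    bichromatic x∈e y∈e = length≥2 (∈-coloursOn⁺ x∈e) (∈-coloursOn⁺ y∈e)

  -- Weak properness on H_{•G}

  module _ {n : ℕ} (u v : Fin n) where

    tripleEdge-left : tripleEdge u v (suc u) ≡ true
    tripleEdge-left = Equivalence.to T-≡ (Equivalence.from (T-∨ {⌊ u ≟ u ⌋} {⌊ u ≟ v ⌋}) (inj₁ (fromWitness refl)))

    tripleEdge-right : tripleEdge u v (suc v) ≡ true
    tripleEdge-right = Equivalence.to T-≡ (Equivalence.from (T-∨ {⌊ v ≟ u ⌋} {⌊ v ≟ v ⌋}) (inj₂ (fromWitness refl)))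

    tripleEdge-members : ∀ x → tripleEdge u v x ≡ true → x ≡ zero ⊎ x ≡ suc u ⊎ x ≡ suc v
    tripleEdge-members zero    _ = inj₁ refl
    tripleEdge-members (suc y) y∈e with Equivalence.to (T-∨ {⌊ y ≟ u ⌋} {⌊ y ≟ v ⌋}) (Equivalence.from T-≡ y∈e)
    ... | inj₁ y≡u = inj₂ (inj₁ (cong suc (toWitness y≡u)))
    ... | inj₂ y≡v = inj₂ (inj₂ (cong suc (toWitness y≡v)))

  exceeds-1 : (k : ℕ) → 2 ≤ k → ⌊ 1 <? k ⌋ ≡ true
  exceeds-1 k 2≤k with 1 <? k
  ... | yes _   = refl
  ... | no  1≮k = ⊥-elim (1≮k 2≤k)

  at-most-1 : (k : ℕ) → k ≤ 1 → ⌊ 1 <? k ⌋ ≡ false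
  at-most-1 k k≤1 with 1 <? k
  ... | yes 1<k = ⊥-elim (≤⇒≯ k≤1 1<k)
  ... | no  _   = refl

  tripleEdge-proper : {n q : ℕ} (φ : Fin (suc n) → Fin q) (u v : Fin n) →
    ⌊ 1 <? length (coloursOn φ (tripleEdge u v)) ⌋ ≡ not (⌊ φ (suc u) ≟ φ zero ⌋ ∧ ⌊ φ (suc v) ≟ φ zero ⌋)
  tripleEdge-proper φ u v with φ (suc u) ≟ φ zero | φ (suc v) ≟ φ zero
  ... | yes u~w | yes v~w = at-most-1 _ (monochromatic φ (tripleEdge u v) same-colour)
    where
    same-colour : ∀ x → tripleEdge u v x ≡ true → φ x ≡ φ zero
    same-colour x x∈e with tripleEdge-members u v x x∈e
    ... | inj₁ refl        = refl
    ... | inj₂ (inj₁ refl) = u~w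
    ... | inj₂ (inj₂ refl) = v~w
  ... | no u≁w  | _       = exceeds-1 _ (bichromatic φ (tripleEdge u v) refl (tripleEdge-left u v) (u≁w ∘ sym))
  ... | yes _   | no v≁w  = exceeds-1 _ (bichromatic φ (tripleEdge u v) refl (tripleEdge-right u v) (v≁w ∘ sym))

  all-++ : {X : Set} (P : X → Bool) → ∀ xs ys → all P (xs ++ ys) ≡ all P xs ∧ all P ys
  all-++ P []       ys = refl
  all-++ P (x ∷ xs) ys = trans (cong (P x ∧_) (all-++ P xs ys)) (sym (∧-assoc (P x) (all P xs) (all P ys)))

  all-concatMap : {X Y : Set} (P : Y → Bool) (g : X → List Y) → ∀ xs → all P (concatMap g xs) ≡ all (λ x → all P (g x)) xs
  all-concatMap P g []       = refl
  all-concatMap P g (x ∷ xs) = trans (all-++ P (g x) (concatMap g xs)) (cong (all P (g x) ∧_) (all-concatMap P g xs))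

  all-cong : {X : Set} {P Q : X → Bool} → (∀ x → P x ≡ Q x) → ∀ xs → all P xs ≡ all Q xs
  all-cong P≗Q xs = cong and (map-cong P≗Q xs)

  weakProper⇔independent : {n q : ℕ} (G : SimpleGraph n) (φ : Fin (suc n) → Fin q) →
    isWeakProper (hyperBullet G) φ ≡ isIndependent G (colourClass (φ zero) (φ ∘ suc))
  weakProper⇔independent {n} G φ =
    trans (all-concatMap sees-two-colours _ (allFin n))
          (all-cong (λ u → trans (all-concatMap sees-two-colours _ (allFin n)) (all-cong (edge-ok u) (allFin n)))
                    (allFin n))
    where
    sees-two-colours : (Fin (suc n) → Bool) → Bool
    sees-two-colours e = ⌊ 1 <? length (coloursOn φ e) ⌋

    A : Fin n → Bool
    A = colourClass (φ zero) (φ ∘ suc)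

    edge-ok : ∀ u v → all sees-two-colours (if adj G u v then tripleEdge u v ∷ [] else []) ≡ not (A u ∧ A v ∧ adj G u v)
    edge-ok u v with adj G u v
    ... | false = cong not (sym (trans (cong (A u ∧_) (∧-zeroʳ (A v))) (∧-zeroʳ (A u))))
    ... | true  = trans (∧-identityʳ _)
                   (trans (tripleEdge-proper φ u v) (cong (λ b → not (A u ∧ b)) (sym (∧-identityʳ (A v)))))

  independent-ext : {n : ℕ} (G : SimpleGraph n) → Extensional (isIndependent G)
  independent-ext {n} G A B A≗B =
    all-cong (λ u → all-cong (λ v → cong₂ (λ a b → not (a ∧ b ∧ adj G u v)) (A≗B u) (A≗B v)) (allFin n)) (allFin n)

  independenceWeight : {n : ℕ} → SimpleGraph n → ℕ → ℕ
  independenceWeight {n} G p = weightedCount (weight p) (isIndependent G) (allSubsets n)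

  colouringCount : {n : ℕ} (G : SimpleGraph n) (p : ℕ) →
    numColourings (hyperBullet G) (suc p) ≡ suc p * independenceWeight G p
  colouringCount {n} G p = begin
    count (isWeakProper (hyperBullet G)) (allFuns colours (suc n))
      ≡⟨ cong length (select-cong (weakProper⇔independent G) (allFuns colours (suc n))) ⟩
    count rootClassIndependent (allFuns colours (suc n))
      ≡⟨ count-as-weightedCount rootClassIndependent (allFuns colours (suc n)) ⟩
    weightedCount (λ _ → 1) rootClassIndependent (allFuns colours (suc n))
      ≡⟨ weightedCount-allFuns colours n (λ _ → 1) rootClassIndependent (λ _ _ _ → refl)
           (λ φ ψ φ≗ψ → independent-ext G _ _ (λ v → cong₂ (λ a b → ⌊ a ≟ b ⌋) (φ≗ψ (suc v)) (φ≗ψ zero))) ⟩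
    sum (map (λ a → weightedCount (λ _ → 1) (rootClassIndependent ∘ cons a) (allFuns colours n)) colours)
      ≡⟨ cong sum (map-cong rootColoured colours) ⟩
    sum (map (λ _ → independenceWeight G p) colours)
      ≡⟨ sum-colours p zero (λ _ → independenceWeight G p) ⟩
    suc p * independenceWeight G p ∎
    where
    open ≡-Reasoning
    colours = allFin (suc p)

    rootClassIndependent : (Fin (suc n) → Fin (suc p)) → Bool
    rootClassIndependent φ = isIndependent G (colourClass (φ zero) (φ ∘ suc))

    -- The colourings giving w the colour a are counted by count-by-colourClass;
    -- their number does not depend on a, so the final sum is over a constant.
    rootColoured : (a : Fin (suc p)) →
      weightedCount (λ _ → 1) (rootClassIndependent ∘ cons a) (allFuns colours n) ≡ independenceWeight G p
    rootColoured a = trans (sym (count-as-weightedCount (rootClassIndependent ∘ cons a) (allFuns colours n)))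
                           (count-by-colourClass p n (isIndependent G) (independent-ext G) a)

module InRationals where

  open import Defs using (_^ℚ_; card)
  open import Data.Nat as ℕ using (ℕ; zero; suc)
  open import Data.Nat.ListAction using (sum)
  import Data.Nat.Properties as ℕₚ
  open import Data.Integer as ℤ using (+_)
  import Data.Integer.Properties as ℤₚ
  open import Data.Integer.Tactic.RingSolver using (solve-∀)
  open import Data.List using (List; []; _∷_; map; foldr)
  open import Data.Fin using (Fin)
  open import Data.Bool using (Bool)
  open import Data.Rational using (ℚ; _/_; _+_; _*_; 0ℚ; 1ℚ; toℚᵘ)
  open import Data.Rational.Properties
    using (toℚᵘ-injective; toℚᵘ-fromℚᵘ; toℚᵘ-homo-+; toℚᵘ-homo-*;
           *-assoc; *-identityˡ; *-identityʳ; *-zeroʳ; *-distribˡ-+; *-1-commutativeMonoid)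
  import Data.Rational.Unnormalised as ℚᵘ
  import Data.Rational.Unnormalised.Properties as ℚᵘₚ
  open import Algebra.Properties.CommutativeMonoid.Mult *-1-commutativeMonoid using (_×_; ×-homo-+; ×-distrib-+)
  open import Relation.Binary.PropositionalEquality using (_≡_; refl; sym; trans; cong; cong₂; module ≡-Reasoning)
  open Counting using (coCard; card+coCard; weight)

  -- The embedding ℕ → ℚ is a semiring homomorphism

  -- The embedding a ↦ a/1, written as in the statement.
  ι : ℕ → ℚ
  ι a = (+ a) / 1

  -- Without normalisation, ι a is the fraction a/1; sums and products are
  -- compared there, where they are computed by cross-multiplication.
  ι-as-ℚᵘ : ∀ a → toℚᵘ (ι a) ℚᵘ.≃ ℚᵘ.mkℚᵘ (+ a) 0
  ι-as-ℚᵘ a = toℚᵘ-fromℚᵘ (ℚᵘ.mkℚᵘ (+ a) 0)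

  ι-+ : ∀ a b → ι (a ℕ.+ b) ≡ ι a + ι b
  ι-+ a b = toℚᵘ-injective (begin
    toℚᵘ (ι (a ℕ.+ b))                                ≈⟨ ι-as-ℚᵘ (a ℕ.+ b) ⟩
    ℚᵘ.mkℚᵘ (+ (a ℕ.+ b)) 0                           ≈⟨ ℚᵘ.*≡* numerators ⟩
    ℚᵘ.mkℚᵘ (+ a) 0 ℚᵘ.+ ℚᵘ.mkℚᵘ (+ b) 0              ≈⟨ ℚᵘₚ.+-cong (ι-as-ℚᵘ a) (ι-as-ℚᵘ b) ⟨
    toℚᵘ (ι a) ℚᵘ.+ toℚᵘ (ι b)                        ≈⟨ toℚᵘ-homo-+ (ι a) (ι b) ⟨
    toℚᵘ (ι a + ι b)                                  ∎)
    where
    open ℚᵘₚ.≃-Reasoning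
    numerators : + (a ℕ.+ b) ℤ.* + 1 ≡ (+ a ℤ.* + 1 ℤ.+ + b ℤ.* + 1) ℤ.* + 1
    numerators = trans (cong (ℤ._* + 1) (ℤₚ.pos-+ a b)) (unit-denominators (+ a) (+ b))
      where unit-denominators : ∀ x y → (x ℤ.+ y) ℤ.* + 1 ≡ (x ℤ.* + 1 ℤ.+ y ℤ.* + 1) ℤ.* + 1
            unit-denominators = solve-∀

  ι-* : ∀ a b → ι (a ℕ.* b) ≡ ι a * ι b
  ι-* a b = toℚᵘ-injective (begin
    toℚᵘ (ι (a ℕ.* b))                                ≈⟨ ι-as-ℚᵘ (a ℕ.* b) ⟩
    ℚᵘ.mkℚᵘ (+ (a ℕ.* b)) 0                           ≈⟨ ℚᵘ.*≡* (cong (ℤ._* + 1) (ℤₚ.pos-* a b)) ⟩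
    ℚᵘ.mkℚᵘ (+ a) 0 ℚᵘ.* ℚᵘ.mkℚᵘ (+ b) 0              ≈⟨ ℚᵘₚ.*-cong (ι-as-ℚᵘ a) (ι-as-ℚᵘ b) ⟨
    toℚᵘ (ι a) ℚᵘ.* toℚᵘ (ι b)                        ≈⟨ toℚᵘ-homo-* (ι a) (ι b) ⟨
    toℚᵘ (ι a * ι b)                                  ∎)
    where open ℚᵘₚ.≃-Reasoning

  ι-^ : ∀ a e → ι (a ℕ.^ e) ≡ ι a ^ℚ e
  ι-^ a zero    = refl
  ι-^ a (suc e) = trans (ι-* a (a ℕ.^ e)) (cong (ι a *_) (ι-^ a e))

  ι-inverse : ∀ k → ι (suc k) * ((+ 1) / suc k) ≡ 1ℚ
  ι-inverse k = toℚᵘ-injective (begin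
    toℚᵘ (ι (suc k) * ((+ 1) / suc k))                 ≈⟨ toℚᵘ-homo-* (ι (suc k)) ((+ 1) / suc k) ⟩
    toℚᵘ (ι (suc k)) ℚᵘ.* toℚᵘ ((+ 1) / suc k)         ≈⟨ ℚᵘₚ.*-cong (ι-as-ℚᵘ (suc k)) (toℚᵘ-fromℚᵘ (ℚᵘ.mkℚᵘ (+ 1) k)) ⟩
    ℚᵘ.mkℚᵘ (+ suc k) 0 ℚᵘ.* ℚᵘ.mkℚᵘ (+ 1) k          ≈⟨ ℚᵘ.*≡* cross-multiplied ⟩
    ℚᵘ.1ℚᵘ                                            ∎)
    where
    open ℚᵘₚ.≃-Reasoning
    cross-multiplied : (+ suc k ℤ.* + 1) ℤ.* + 1 ≡ + 1 ℤ.* (+ (1 ℕ.* suc k))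
    cross-multiplied = trans (units (+ suc k)) (cong (λ n → + 1 ℤ.* + n) (sym (ℕₚ.*-identityˡ (suc k))))
      where units : ∀ x → (x ℤ.* + 1) ℤ.* + 1 ≡ + 1 ℤ.* x
            units = solve-∀

  ^ℚ-as-× : ∀ (x : ℚ) i → x ^ℚ i ≡ i × x
  ^ℚ-as-× x zero    = refl
  ^ℚ-as-× x (suc i) = cong (x *_) (^ℚ-as-× x i)

  ^ℚ-+ : ∀ (x : ℚ) i j → x ^ℚ (i ℕ.+ j) ≡ x ^ℚ i * x ^ℚ j
  ^ℚ-+ x i j = trans (^ℚ-as-× x (i ℕ.+ j))
    (trans (×-homo-+ x i j) (sym (cong₂ _*_ (^ℚ-as-× x i) (^ℚ-as-× x j))))

  ^ℚ-* : ∀ (x y : ℚ) i → (x * y) ^ℚ i ≡ x ^ℚ i * y ^ℚ i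
  ^ℚ-* x y i = trans (^ℚ-as-× (x * y) i)
    (trans (×-distrib-+ x y i) (sym (cong₂ _*_ (^ℚ-as-× x i) (^ℚ-as-× y i))))

  1^ℚ : ∀ i → 1ℚ ^ℚ i ≡ 1ℚ
  1^ℚ zero    = refl
  1^ℚ (suc i) = trans (*-identityˡ (1ℚ ^ℚ i)) (1^ℚ i)

  -- Step 3: from the weights p^{|V∖A|} to the independence polynomial

  weight-in-ℚ : (k : ℕ) {n : ℕ} (A : Fin n → Bool) →
    ι (weight (suc k) A) ≡ ι (suc k) ^ℚ n * ((+ 1) / suc k) ^ℚ card A
  weight-in-ℚ k {n} A = sym (begin
    p ^ℚ n * x ^ℚ c                ≡⟨ cong (λ e → p ^ℚ e * x ^ℚ c) (sym (card+coCard A)) ⟩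
    p ^ℚ (c ℕ.+ f) * x ^ℚ c        ≡⟨ cong (λ e → p ^ℚ e * x ^ℚ c) (ℕₚ.+-comm c f) ⟩
    p ^ℚ (f ℕ.+ c) * x ^ℚ c        ≡⟨ cong (_* x ^ℚ c) (^ℚ-+ p f c) ⟩
    (p ^ℚ f * p ^ℚ c) * x ^ℚ c     ≡⟨ *-assoc (p ^ℚ f) (p ^ℚ c) (x ^ℚ c) ⟩
    p ^ℚ f * (p ^ℚ c * x ^ℚ c)     ≡⟨ cong (p ^ℚ f *_) (^ℚ-* p x c) ⟨
    p ^ℚ f * (p * x) ^ℚ c          ≡⟨ cong (λ y → p ^ℚ f * y ^ℚ c) (ι-inverse k) ⟩
    p ^ℚ f * 1ℚ ^ℚ c               ≡⟨ cong (p ^ℚ f *_) (1^ℚ c) ⟩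
    p ^ℚ f * 1ℚ                    ≡⟨ *-identityʳ (p ^ℚ f) ⟩
    p ^ℚ f                         ≡⟨ ι-^ (suc k) f ⟨
    ι (suc k ℕ.^ f)                ∎)
    where
    open ≡-Reasoning
    p = ι (suc k)
    x = (+ 1) / suc k
    c = card A
    f = coCard A

  weightedSum-in-ℚ : (k : ℕ) {n : ℕ} (As : List (Fin n → Bool)) →
    ι (sum (map (weight (suc k)) As)) ≡ ι (suc k) ^ℚ n * foldr (λ A acc → ((+ 1) / suc k) ^ℚ card A + acc) 0ℚ As
  weightedSum-in-ℚ k {n} []       = sym (*-zeroʳ (ι (suc k) ^ℚ n))
  weightedSum-in-ℚ k {n} (A ∷ As) = begin
    ι (weight (suc k) A ℕ.+ sum (map (weight (suc k)) As))      ≡⟨ ι-+ (weight (suc k) A) _ ⟩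
    ι (weight (suc k) A) + ι (sum (map (weight (suc k)) As))    ≡⟨ cong₂ _+_ (weight-in-ℚ k A) (weightedSum-in-ℚ k As) ⟩
    pⁿ * x ^ℚ card A + pⁿ * rest                               ≡⟨ *-distribˡ-+ pⁿ (x ^ℚ card A) rest ⟨
    pⁿ * (x ^ℚ card A + rest)                                  ∎
    where
    open ≡-Reasoning
    pⁿ = ι (suc k) ^ℚ n
    x = (+ 1) / suc k
    rest = foldr (λ A acc → x ^ℚ card A + acc) 0ℚ As

open import Defs
open import Data.Nat as ℕ using (ℕ; suc)
open import Data.Integer using (+_)
open import Data.Rational using (ℚ; _/_; _*_)
open import Data.Rational.Properties using (*-assoc)
open import Relation.Binary.PropositionalEquality using (_≡_; cong; module ≡-Reasoning)
open Counting using (colouringCount; independenceWeight; select)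
open InRationals using (ι; ι-*; weightedSum-in-ℚ)

-- With λ = k + 2 colours: P(H_{•G}, λ) = λ Σ_{A independent} (λ-1)^{n-|A|}
-- (colouringCount), and the sum is (λ-1)^n I(G, 1/(λ-1)) (weightedSum-in-ℚ).
theorem1 : (n : ℕ) (G : SimpleGraph n) (k : ℕ) →
    (+ numColourings (hyperBullet G) (suc (suc k))) / 1
      ≡ ((+ suc (suc k)) / 1) * (((+ suc k) / 1) ^ℚ n)
          * indepPoly G ((+ 1) / suc k)
theorem1 n G k = begin
  ι (numColourings (hyperBullet G) q)      ≡⟨ cong ι (colouringCount G (suc k)) ⟩
  ι (q ℕ.* independenceWeight G (suc k))   ≡⟨ ι-* q (independenceWeight G (suc k)) ⟩
  ι q * ι (independenceWeight G (suc k))   ≡⟨ cong (ι q *_) (weightedSum-in-ℚ k (select (isIndependent G) (allSubsets n))) ⟩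
  ι q * (ι (suc k) ^ℚ n * I)               ≡⟨ *-assoc (ι q) (ι (suc k) ^ℚ n) I ⟨
  ι q * ι (suc k) ^ℚ n * I                 ∎
  where
  open ≡-Reasoning
  q = suc (suc k)
  I = indepPoly G ((+ 1) / suc k)
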